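{- Let $\mathbf{A}$ be an algebra such that every subalgebra $\mathbf{B}$ of $\mathbf{A}\times\mathbf{A}$ generated by $4$ elements satisfies \[\beta\cap(\gamma\circ\delta\circ\gamma)\subseteq (\beta\cap\gamma)+\delta\] for all congruences $\beta,\gamma,\delta$ of $\mathbf{B}$ with $\delta\subseteq\beta$. Then for all reflexive binary relations $R,S$ on $A$ and every congruence $\alpha$ of $\mathbf{A}$, \[\alpha\cap(R\circ S)\subseteq\big(\alpha\cap\overline{R\cup S^- }\big)+\big(\alpha\cap\overline{R^-\cup S}\big).\]
   Context: For binary relations $R,S$ on a set, $R\circ S=\{(a,c):\exists b\, aRb,\ bSc\}$, and $R+S=\bigcup_{n\ge1}(R\circ S\circ R\circ S\circ\cdots)$ with $n$ factors alternating; for reflexive $R,S$ this is the transitive closure of $R\cup S$. $R^-=\{(b,a):(a,b)\in R\}$ is the converse of $R$. For a binary relation $R$ on an algebra, $\overline{R}$ denotes the smallest compatible (admissible) relation containing $R$. For congruences, $+$ is the join in the congruence lattice. -}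

module Defs where

open import Data.Nat using (ℕ)
open import Data.Fin using (Fin)
open import Data.Product using (_×_; _,_; proj₁; proj₂; Σ; ∃)
open import Data.Sum using (_⊎_)

record Signature : Set₁ where
  field
    Op    : Set
    arity : Op → ℕ
open Signature public

record Algebra (σ : Signature) : Set₁ where
  field
    Carrier : Set
    op      : (f : Op σ) → (Fin (arity σ f) → Carrier) → Carrier
open Algebra public

BRel : Set → Set₁
BRel A = A → A → Set

Pred : Set → Set₁
Pred A = A → Set

module _ {A : Set} where
  _⊆ᵣ_ : BRel A → BRel A → Set
  R ⊆ᵣ S = ∀ {a b} → R a b → S a b

  _∩ᵣ_ : BRel A → BRel A → BRel A
  (R ∩ᵣ S) a b = R a b × S a b

  _∪ᵣ_ : BRel A → BRel A → BRel A
  (R ∪ᵣ S) a b = R a b ⊎ S a b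

  _⁻ : BRel A → BRel A
  (R ⁻) a b = R b a

  _∘ᵣ_ : BRel A → BRel A → BRel A
  (R ∘ᵣ S) a c = ∃ λ b → R a b × S b c

  ReflexiveRel : BRel A → Set
  ReflexiveRel R = ∀ a → R a a

  -- Alt R S a c : (a,c) ∈ R ∘ S ∘ R ∘ S ∘ ⋯ (n ≥ 1 alternating factors, starting with R)
  data Alt (R S : BRel A) : A → A → Set where
    one  : ∀ {a b} → R a b → Alt R S a b
    step : ∀ {a b c} → R a b → Alt S R b c → Alt R S a c

  _+ᵣ_ : BRel A → BRel A → BRel A
  R +ᵣ S = Alt R S

module _ {σ : Signature} (𝑨 : Algebra σ) where
  private A = Carrier 𝑨

  Compatible : BRel A → Set
  Compatible R = ∀ (f : Op σ) (x y : Fin (arity σ f) → A)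
               → (∀ i → R (x i) (y i)) → R (op 𝑨 f x) (op 𝑨 f y)

  record IsCongruence (θ : BRel A) : Set where
    field
      refl  : ∀ a → θ a a
      sym   : ∀ {a b} → θ a b → θ b a
      trans : ∀ {a b c} → θ a b → θ b c → θ a c
      compat : Compatible θ

  data Cl (R : BRel A) : A → A → Set where
    base : ∀ {a b} → R a b → Cl R a b
    app  : ∀ (f : Op σ) (x y : Fin (arity σ f) → A)
         → (∀ i → Cl R (x i) (y i)) → Cl R (op 𝑨 f x) (op 𝑨 f y)

  data Sg {I : Set} (g : I → A) : A → Set where
    gen : ∀ i → Sg g (g i)
    app : ∀ (f : Op σ) (x : Fin (arity σ f) → A)
        → (∀ i → Sg g (x i)) → Sg g (op 𝑨 f x)

  -- Congruences of the subalgebra 𝑩 of 𝑨 with universe U, represented as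
  -- relations on A supported on U × U.
  record IsCongruenceOn (U : Pred A) (θ : BRel A) : Set where
    field
      support : ∀ {a b} → θ a b → U a × U b
      refl    : ∀ a → U a → θ a a
      sym     : ∀ {a b} → θ a b → θ b a
      trans   : ∀ {a b c} → θ a b → θ b c → θ a c
      compat  : ∀ (f : Op σ) (x y : Fin (arity σ f) → A)
              → (∀ i → θ (x i) (y i)) → θ (op 𝑨 f x) (op 𝑨 f y)

_²ᴬ : ∀ {σ} → Algebra σ → Algebra σ
Carrier (𝑨 ²ᴬ) = Carrier 𝑨 × Carrier 𝑨
op (𝑨 ²ᴬ) f x = op 𝑨 f (λ i → proj₁ (x i)) , op 𝑨 f (λ i → proj₂ (x i))

FourGenCondition : ∀ {σ} → Algebra σ → Set₁
FourGenCondition 𝑨 =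
  ∀ (g : Fin 4 → Carrier (𝑨 ²ᴬ)) (β γ δ : BRel (Carrier (𝑨 ²ᴬ)))
  → IsCongruenceOn (𝑨 ²ᴬ) (Sg (𝑨 ²ᴬ) g) β
  → IsCongruenceOn (𝑨 ²ᴬ) (Sg (𝑨 ²ᴬ) g) γ
  → IsCongruenceOn (𝑨 ²ᴬ) (Sg (𝑨 ²ᴬ) g) δ
  → δ ⊆ᵣ β
  → (β ∩ᵣ (γ ∘ᵣ (δ ∘ᵣ γ))) ⊆ᵣ ((β ∩ᵣ γ) +ᵣ δ)

{-# OPTIONS --safe #-}
module Submission where

-- Let T = Cl(R ∪ S⁻), Z = α ∩ T and θ the equivalence closure of Z. As Z is reflexive
-- and Z⁻ ⊆ α ∩ Cl(R⁻ ∪ S), θ lies in the right-hand side, so it suffices to show a θ c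
-- whenever a α c, a R b, b S c. Let B ≤ 𝑨 × 𝑨 be generated by (a,a), (a,b), (c,b), (c,c);
-- all pairs of B lie in T. On B take β = α × α, γ = θ × ∇ and δ = α × θ, so δ ⊆ β, and
-- (a,a) γ (a,b) δ (c,b) γ (c,c). The hypothesis yields a chain of (β ∩ γ)- and δ-steps from
-- (a,a) to (c,c). Along it the pairs stay in Z (β preserves α within each pair), and the
-- first coordinates move within θ: directly for a β ∩ γ-step, and through p₁ Z p₂ θ q₂ Z⁻ q₁
-- for a δ-step from p to q.

open import Defs
open import Data.Fin using (Fin; zero; suc)
open import Data.Nat using (zero; suc)
open import Data.Product using (_×_; _,_; proj₁; proj₂; uncurry)
open import Data.Product.Relation.Binary.Pointwise.NonDependent using (Pointwise)
open import Data.Sum using (inj₁; inj₂)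
open import Data.Vec.Functional using (_∷_; []; head; tail)
open import Relation.Binary.Construct.Always using (Always)
open import Relation.Binary.Construct.Closure.Equivalence
  using (EqClosure; symmetric; transitive; gmap; fold; return)
open import Relation.Binary.Construct.Closure.ReflexiveTransitive using (ε; _◅_; _◅◅_)
open import Relation.Binary.Construct.Closure.Symmetric using (fwd; bwd)
open import Relation.Binary.Definitions using (Transitive)
open import Relation.Binary.Structures using (IsEquivalence)

private
  variable
    σ : Signature
    A : Set
    X Y K : BRel A

Alt-flip : ReflexiveRel Y → Alt X Y ⊆ᵣ Alt Y X
Alt-flip Y-refl r = step (Y-refl _) r

+ᵣ-least : Transitive K → X ⊆ᵣ K → Y ⊆ᵣ K → (X +ᵣ Y) ⊆ᵣ K
+ᵣ-least K-trans X⊆K Y⊆K (one x)    = X⊆K x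
+ᵣ-least K-trans X⊆K Y⊆K (step x r) = K-trans (X⊆K x) (+ᵣ-least K-trans Y⊆K X⊆K r)

EqClosure⊆+ᵣ : ReflexiveRel X → ReflexiveRel Y → (X ⁻) ⊆ᵣ Y → EqClosure X ⊆ᵣ (X +ᵣ Y)
EqClosure⊆+ᵣ X-refl Y-refl X⁻⊆Y ε           = one (X-refl _)
EqClosure⊆+ᵣ X-refl Y-refl X⁻⊆Y (fwd x ◅ p) =
  step x (Alt-flip Y-refl (EqClosure⊆+ᵣ X-refl Y-refl X⁻⊆Y p))
EqClosure⊆+ᵣ X-refl Y-refl X⁻⊆Y (bwd x ◅ p) =
  Alt-flip X-refl (step (X⁻⊆Y x) (EqClosure⊆+ᵣ X-refl Y-refl X⁻⊆Y p))

module _ {A : Set} {Z : BRel A} (Z-refl : ReflexiveRel Z) where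

  private
    head∷tail-related : ∀ {n} (x : Fin (suc n) → A) i → Z (x i) ((head x ∷ tail x) i)
    head∷tail-related x zero    = Z-refl _
    head∷tail-related x (suc i) = Z-refl _

  -- Change one argument at a time; reflexivity of Z keeps the other arguments fixed
  -- and bridges x with head x ∷ tail x, which agree only pointwise.
  EqClosure-preserved : ∀ n (h : (Fin n → A) → A)
    → (∀ {x y} → (∀ i → Z (x i) (y i)) → Z (h x) (h y))
    → ∀ {x y} → (∀ i → EqClosure Z (x i) (y i)) → EqClosure Z (h x) (h y)
  EqClosure-preserved zero    h h-mono _ = return (h-mono λ ())
  EqClosure-preserved (suc n) h h-mono {x} {y} x~y =
    return (h-mono (head∷tail-related x))
    ◅◅ gmap (λ u → h (u ∷ tail x)) first-preserved (x~y zero)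
    ◅◅ EqClosure-preserved n (λ t → h (head y ∷ t)) tail-preserved (λ i → x~y (suc i))
    ◅◅ symmetric Z (return (h-mono (head∷tail-related y)))
    where
      first-preserved : ∀ {u v} → Z u v → Z (h (u ∷ tail x)) (h (v ∷ tail x))
      first-preserved z = h-mono λ { zero → z ; (suc i) → Z-refl _ }
      tail-preserved : ∀ {s t} → (∀ i → Z (s i) (t i)) → Z (h (head y ∷ s)) (h (head y ∷ t))
      tail-preserved s~t = h-mono λ { zero → Z-refl _ ; (suc i) → s~t i }

module _ {𝑨 : Algebra σ} where

  Cl-converse : ∀ {R : BRel (Carrier 𝑨)} → Cl 𝑨 R ⊆ᵣ (Cl 𝑨 (R ⁻) ⁻)
  Cl-converse (base r)      = base r
  Cl-converse (app f x y h) = app f y x (λ i → Cl-converse (h i))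

  ∩-Cl-refl : ∀ {R α : BRel (Carrier 𝑨)} → IsCongruence 𝑨 α → ReflexiveRel R
    → ReflexiveRel (α ∩ᵣ Cl 𝑨 R)
  ∩-Cl-refl α-cong R-refl a = IsCongruence.refl α-cong a , base (R-refl a)

  ∩-Cl-compatible : ∀ {R α : BRel (Carrier 𝑨)} → IsCongruence 𝑨 α
    → Compatible 𝑨 (α ∩ᵣ Cl 𝑨 R)
  ∩-Cl-compatible α-cong f x y x~y =
    IsCongruence.compat α-cong f x y (λ i → proj₁ (x~y i)) , app f x y (λ i → proj₂ (x~y i))

  ∩-Cl-converse : ∀ {R α : BRel (Carrier 𝑨)} → IsCongruence 𝑨 α
    → ((α ∩ᵣ Cl 𝑨 R) ⁻) ⊆ᵣ (α ∩ᵣ Cl 𝑨 (R ⁻))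
  ∩-Cl-converse α-cong (αba , Rba) = IsCongruence.sym α-cong αba , Cl-converse Rba

  IsCongruence⇒IsEquivalence : ∀ {θ : BRel (Carrier 𝑨)} → IsCongruence 𝑨 θ → IsEquivalence θ
  IsCongruence⇒IsEquivalence θ-cong = record { refl = refl _ ; sym = sym ; trans = trans }
    where open IsCongruence θ-cong

  EqClosure-isCongruence : ∀ {Z : BRel (Carrier 𝑨)}
    → ReflexiveRel Z → Compatible 𝑨 Z → IsCongruence 𝑨 (EqClosure Z)
  EqClosure-isCongruence {Z} Z-refl Z-compat = record
    { refl   = λ _ → ε
    ; sym    = symmetric Z
    ; trans  = transitive Z
    ; compat = λ f x y → EqClosure-preserved Z-refl _ (op 𝑨 f) (Z-compat f _ _)
    }

  Always-isCongruence : IsCongruence 𝑨 Always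
  Always-isCongruence = record
    { refl = λ _ → _ ; sym = λ _ → _ ; trans = λ _ _ → _ ; compat = λ _ _ _ _ → _ }

  Pointwise-isCongruence : ∀ {θ₁ θ₂ : BRel (Carrier 𝑨)}
    → IsCongruence 𝑨 θ₁ → IsCongruence 𝑨 θ₂ → IsCongruence (𝑨 ²ᴬ) (Pointwise θ₁ θ₂)
  Pointwise-isCongruence θ₁-cong θ₂-cong = record
    { refl   = λ _ → θ₁.refl _ , θ₂.refl _
    ; sym    = λ (x₁ , x₂) → θ₁.sym x₁ , θ₂.sym x₂
    ; trans  = λ (x₁ , x₂) (y₁ , y₂) → θ₁.trans x₁ y₁ , θ₂.trans x₂ y₂
    ; compat = λ f x y x~y → θ₁.compat f _ _ (λ i → proj₁ (x~y i))
                           , θ₂.compat f _ _ (λ i → proj₂ (x~y i))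
    }
    where module θ₁ = IsCongruence θ₁-cong
          module θ₂ = IsCongruence θ₂-cong

  Sg²⊆ : ∀ {T : BRel (Carrier 𝑨)} {I : Set} {g : I → Carrier (𝑨 ²ᴬ)}
    → Compatible 𝑨 T → (∀ i → uncurry T (g i)) → ∀ {p} → Sg (𝑨 ²ᴬ) g p → uncurry T p
  Sg²⊆     T-compat g∈T (gen i)     = g∈T i
  Sg²⊆ {T} T-compat g∈T (app f x u) = T-compat f _ _ (λ i → Sg²⊆ {T} T-compat g∈T (u i))

IsSubuniverse : (𝑩 : Algebra σ) → Pred (Carrier 𝑩) → Set
IsSubuniverse 𝑩 U = ∀ f x → (∀ i → U (x i)) → U (op 𝑩 f x)

Restrict : Pred A → BRel A → BRel A
Restrict U θ p q = U p × U q × θ p q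

Restrict-isCongruenceOn : ∀ {𝑩 : Algebra σ} {U θ} → IsSubuniverse 𝑩 U → IsCongruence 𝑩 θ
  → IsCongruenceOn 𝑩 U (Restrict U θ)
Restrict-isCongruenceOn U-sub θ-cong = record
  { support = λ (u , v , _) → u , v
  ; refl    = λ p u → u , u , refl p
  ; sym     = λ (u , v , pθq) → v , u , sym pθq
  ; trans   = λ (u , _ , pθq) (_ , w , qθr) → u , w , trans pθq qθr
  ; compat  = λ f x y x~y → U-sub f x (λ i → proj₁ (x~y i))
                          , U-sub f y (λ i → proj₁ (proj₂ (x~y i)))
                          , compat f x y (λ i → proj₂ (proj₂ (x~y i)))
  }
  where open IsCongruence θ-cong

module _ {𝑨 : Algebra σ} {R S α : BRel (Carrier 𝑨)}
         (R-refl : ReflexiveRel R) (α-cong : IsCongruence 𝑨 α) where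

  private
    module α = IsCongruence α-cong
    T Z θ : BRel (Carrier 𝑨)
    T = Cl 𝑨 (R ∪ᵣ (S ⁻))
    Z = α ∩ᵣ T
    θ = EqClosure Z

    Z-refl : ReflexiveRel Z
    Z-refl = ∩-Cl-refl α-cong (λ a → inj₁ (R-refl a))

    θ-isCongruence : IsCongruence 𝑨 θ
    θ-isCongruence = EqClosure-isCongruence Z-refl (∩-Cl-compatible α-cong)

    θ⊆α : θ ⊆ᵣ α
    θ⊆α = fold (IsCongruence⇒IsEquivalence α-cong) proj₁

  module FourGenerated (g : Fin 4 → Carrier (𝑨 ²ᴬ)) where

    β γ δ Carries : BRel (Carrier (𝑨 ²ᴬ))
    β = Restrict (Sg (𝑨 ²ᴬ) g) (Pointwise α α)
    γ = Restrict (Sg (𝑨 ²ᴬ) g) (Pointwise θ Always)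
    δ = Restrict (Sg (𝑨 ²ᴬ) g) (Pointwise α θ)
    Carries p q = uncurry Z p → θ (proj₁ p) (proj₁ q) × uncurry Z q

    β-cong : IsCongruenceOn (𝑨 ²ᴬ) (Sg (𝑨 ²ᴬ) g) β
    β-cong = Restrict-isCongruenceOn app (Pointwise-isCongruence α-cong α-cong)

    γ-cong : IsCongruenceOn (𝑨 ²ᴬ) (Sg (𝑨 ²ᴬ) g) γ
    γ-cong = Restrict-isCongruenceOn app
               (Pointwise-isCongruence θ-isCongruence Always-isCongruence)

    δ-cong : IsCongruenceOn (𝑨 ²ᴬ) (Sg (𝑨 ²ᴬ) g) δ
    δ-cong = Restrict-isCongruenceOn app (Pointwise-isCongruence α-cong θ-isCongruence)

    δ⊆β : δ ⊆ᵣ β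
    δ⊆β (u , v , αpq , θpq) = u , v , αpq , θ⊆α θpq

    Carries-trans : Transitive Carries
    Carries-trans carries-pq carries-qr Zp =
      let (θpq , Zq) = carries-pq Zp
          (θqr , Zr) = carries-qr Zq
      in θpq ◅◅ θqr , Zr

    module _ (g∈T : ∀ i → uncurry T (g i)) where

      β-preserves-Z : ∀ {p q} → β p q → uncurry Z p → uncurry Z q
      β-preserves-Z (_ , v , αpq₁ , αpq₂) (αp , _) =
        α.trans (α.sym αpq₁) (α.trans αp αpq₂) , Sg²⊆ {T = T} app g∈T v

      β∩γ⊆Carries : (β ∩ᵣ γ) ⊆ᵣ Carries
      β∩γ⊆Carries (βpq , (_ , _ , θpq₁ , _)) Zp = θpq₁ , β-preserves-Z βpq Zp

      δ⊆Carries : δ ⊆ᵣ Carries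
      δ⊆Carries δpq@(_ , _ , _ , θpq₂) Zp =
        fwd Zp ◅ θpq₂ ◅◅ bwd Zq ◅ ε , Zq
        where Zq = β-preserves-Z (δ⊆β δpq) Zp

  α∩R∘S⊆θ : FourGenCondition 𝑨 → (α ∩ᵣ (R ∘ᵣ S)) ⊆ᵣ θ
  α∩R∘S⊆θ H {a} {c} (αac , b , Rab , Sbc) =
    proj₁ (+ᵣ-least Carries-trans (β∩γ⊆Carries g∈T) (δ⊆Carries g∈T) chain (Z-refl a))
    where
      g : Fin 4 → Carrier (𝑨 ²ᴬ)
      g = (a , a) ∷ (a , b) ∷ (c , b) ∷ (c , c) ∷ []
      open FourGenerated g
      g∈T : ∀ i → uncurry T (g i)
      g∈T zero                   = base (inj₁ (R-refl a))
      g∈T (suc zero)             = base (inj₁ Rab)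
      g∈T (suc (suc zero))       = base (inj₂ Sbc)
      g∈T (suc (suc (suc zero))) = base (inj₁ (R-refl c))
      chain : ((β ∩ᵣ γ) +ᵣ δ) (a , a) (c , c)
      chain = H g β γ δ β-cong γ-cong δ-cong δ⊆β
        ( (gen zero , gen (suc (suc (suc zero))) , αac , αac)
        , (a , b) , (gen zero , gen (suc zero) , ε , _)
        , (c , b) , (gen (suc zero) , gen (suc (suc zero)) , αac , ε)
        , (gen (suc (suc zero)) , gen (suc (suc (suc zero))) , ε , _) )

proposition2p2 : ∀ {σ : Signature} (𝑨 : Algebra σ)
    → FourGenCondition 𝑨
    → ∀ (R S α : BRel (Carrier 𝑨))
    → ReflexiveRel R → ReflexiveRel S → IsCongruence 𝑨 α
    → (α ∩ᵣ (R ∘ᵣ S)) ⊆ᵣ ((α ∩ᵣ Cl 𝑨 (R ∪ᵣ (S ⁻))) +ᵣ (α ∩ᵣ Cl 𝑨 ((R ⁻) ∪ᵣ S)))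
proposition2p2 𝑨 H R S α R-refl _ α-cong αRSac =
  EqClosure⊆+ᵣ (∩-Cl-refl α-cong (λ a → inj₁ (R-refl a)))
               (∩-Cl-refl α-cong (λ a → inj₁ (R-refl a)))
               (∩-Cl-converse α-cong)
               (α∩R∘S⊆θ R-refl α-cong H αRSac)
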